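{- Let $\mathcal{G}$ be a finite abstract simplicial complex with its star topology. For every subset $A\subseteq\mathcal{G}$ define the Wu characteristic $\omega(A)=\sum_{x,y\in A,\ x\cap y\in A}\omega(x)\omega(y)$, where $\omega(x)=(-1)^{\dim x}$. Then for all open sets $U,V\subseteq\mathcal{G}$, $$\omega(U\cup V)=\omega(U)+\omega(V)-\omega(U\cap V).$$
   Context: A finite abstract simplicial complex $\mathcal{G}$ is a finite set of non-empty finite sets such that every non-empty subset of an element of $\mathcal{G}$ is again in $\mathcal{G}$; $\dim x=|x|-1$. Note $x\cap y\in A$ in particular requires $x\cap y\neq\emptyset$. For $x \in \mathcal{G}$ the star is $U(x)=\{y \in \mathcal{G} : x \subseteq y\}$; the stars together with $\emptyset$ form a basis of the star topology on $\mathcal{G}$. -}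

module Defs where

open import Data.Nat using (ℕ; zero; suc; _∸_)
open import Data.Bool using (Bool; true; false; _∧_; _∨_; if_then_else_)
open import Data.Vec using (_∷_; [])
open import Data.List using (List; []; _∷_; map; _++_)
open import Data.List.Relation.Unary.All using (All)
open import Data.List.Relation.Unary.Any using (Any)
open import Data.Integer using (ℤ; -[1+_]; _+_; _*_; _^_) renaming (+_ to pos)
open import Data.Fin.Subset using (Subset; _∩_; _⊆_; ∣_∣; Nonempty; outside; inside)
open import Data.Product using (Σ; _×_)
open import Relation.Binary.PropositionalEquality using (_≡_)

-- Vertices are Fin n; a (candidate) simplex is a subset of Fin n.
-- A set of simplices (subset of the power set) is a Boolean predicate.
SetOfSimplices : ℕ → Set
SetOfSimplices n = Subset n → Bool

IsComplex : {n : ℕ} → SetOfSimplices n → Set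
IsComplex {n} G =
  ((x : Subset n) → G x ≡ true → Nonempty x) ×
  ((x y : Subset n) → G x ≡ true → y ⊆ x → Nonempty y → G y ≡ true)

_⊆ₛ_ : {n : ℕ} → SetOfSimplices n → SetOfSimplices n → Set
_⊆ₛ_ {n} A B = (x : Subset n) → A x ≡ true → B x ≡ true

_∪ₛ_ : {n : ℕ} → SetOfSimplices n → SetOfSimplices n → SetOfSimplices n
(A ∪ₛ B) x = A x ∨ B x

_∩ₛ_ : {n : ℕ} → SetOfSimplices n → SetOfSimplices n → SetOfSimplices n
(A ∩ₛ B) x = A x ∧ B x

-- Open sets of the star topology: unions of stars U(z) = {x ∈ G : z ⊆ x}, z ∈ G
-- (the empty union gives ∅).
IsOpen : {n : ℕ} → SetOfSimplices n → SetOfSimplices n → Set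
IsOpen {n} G U =
  Σ (List (Subset n)) λ zs →
    All (λ z → G z ≡ true) zs ×
    ((x : Subset n) →
      (U x ≡ true → G x ≡ true × Any (λ z → z ⊆ x) zs) ×
      (G x ≡ true × Any (λ z → z ⊆ x) zs → U x ≡ true))

allSubsets : (n : ℕ) → List (Subset n)
allSubsets zero = [] ∷ []
allSubsets (suc n) = map (outside ∷_) (allSubsets n) ++ map (inside ∷_) (allSubsets n)

sumL : {A : Set} → List A → (A → ℤ) → ℤ
sumL [] f = pos 0
sumL (a ∷ as) f = f a + sumL as f

-- ω(x) = (-1)^dim x, dim x = |x| - 1
ωs : {n : ℕ} → Subset n → ℤ
ωs x = -[1+ 0 ] ^ (∣ x ∣ ∸ 1)

wu : {n : ℕ} → SetOfSimplices n → ℤ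
wu {n} A = sumL (allSubsets n) λ x → sumL (allSubsets n) λ y →
  if A x ∧ A y ∧ A (x ∩ y) then ωs x * ωs y else pos 0

-- An open set of the star topology is an up-set of G: with any simplex it contains every
-- simplex of G above it.  Hence if x ∩ y lies in U, then x, y ∈ U ∪ V already lie in U,
-- so the pairs (x, y) counted by ω(U ∪ V) are exactly those counted by ω(U) or by ω(V),
-- while those counted by ω(U ∩ V) are those counted by both.  Inclusion–exclusion for the
-- indicator of each pair, summed with the weights ω(x) ω(y), gives the valuation formula.
module Submission where

open import Defs
open import Algebra.Bundles using (CommutativeMonoid)
open import Data.Bool using (Bool; true; false; _∧_; _∨_; if_then_else_)
open import Data.Bool.Properties using (∧-zeroʳ; ∧-commutativeMonoid)
open import Algebra.Properties.CommutativeSemigroup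
  (CommutativeMonoid.commutativeSemigroup ∧-commutativeMonoid)
  using (interchange)
open import Data.Fin.Subset using (Subset; _∩_; _⊆_)
open import Data.Fin.Subset.Properties using (⊆-trans; p∩q⊆p; p∩q⊆q)
open import Data.Integer using (ℤ; _+_; _-_; _*_) renaming (+_ to pos)
open import Data.Integer.Solver using (module +-*-Solver)
open +-*-Solver using (solve; _:=_; _:+_; _:-_; con)
open import Data.List using (List; []; _∷_)
open import Data.List.Relation.Unary.Any using (Any; here; there)
open import Data.Nat using (ℕ)
open import Data.Product using (_×_; _,_; proj₁; proj₂)
open import Relation.Binary.PropositionalEquality
  using (_≡_; refl; cong; cong₂; trans; sym; module ≡-Reasoning)

∨-absorbʳ-by : {a b : Bool} → (a ∨ b ≡ true → a ≡ true) → a ∨ b ≡ a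
∨-absorbʳ-by {true}          _ = refl
∨-absorbʳ-by {false} {false} _ = refl
∨-absorbʳ-by {false} {true}  h = sym (h refl)

∧-distribˡ-∨-under : (a b c d : Bool) → a ∧ b ∧ (c ∨ d) ≡ (a ∧ b ∧ c) ∨ (a ∧ b ∧ d)
∧-distribˡ-∨-under false _     _ _ = refl
∧-distribˡ-∨-under true  false _ _ = refl
∧-distribˡ-∨-under true  true  _ _ = refl

∧-congʳ-when : {a a′ b b′ c : Bool} → (c ≡ true → a ≡ a′ × b ≡ b′) →
  a ∧ b ∧ c ≡ a′ ∧ b′ ∧ c
∧-congʳ-when {c = true} h with h refl
... | refl , refl = refl
∧-congʳ-when {a} {a′} {b} {b′} {false} _
  rewrite ∧-zeroʳ b | ∧-zeroʳ b′ | ∧-zeroʳ a | ∧-zeroʳ a′ = refl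

UpClosedIn : {n : ℕ} → SetOfSimplices n → SetOfSimplices n → Set
UpClosedIn {n} G U = (a x : Subset n) → U a ≡ true → G x ≡ true → a ⊆ x → U x ≡ true

open⇒⊆ₛ : {n : ℕ} {G U : SetOfSimplices n} → IsOpen G U → U ⊆ₛ G
open⇒⊆ₛ (_ , _ , spec) x ux = proj₁ (proj₁ (spec x) ux)

open⇒upClosed : {n : ℕ} {G U : SetOfSimplices n} → IsOpen G U → UpClosedIn G U
open⇒upClosed (_ , _ , spec) a x ua gx a⊆x =
  proj₂ (spec x) (gx , lift (proj₂ (proj₁ (spec a) ua)))
  where
  lift : {ws : List (Subset _)} → Any (_⊆ a) ws → Any (_⊆ x) ws
  lift (here z⊆a)  = here (⊆-trans z⊆a a⊆x)
  lift (there any) = there (lift any)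

Admits : {n : ℕ} → SetOfSimplices n → Subset n → Subset n → Bool
Admits A x y = A x ∧ A y ∧ A (x ∩ y)

module _ {n : ℕ} {G U V : SetOfSimplices n}
         (U⊆G : U ⊆ₛ G) (V⊆G : V ⊆ₛ G)
         (U-up : UpClosedIn G U) (V-up : UpClosedIn G V) where

  ∪ₛ⊆G : (x : Subset n) → (U ∪ₛ V) x ≡ true → G x ≡ true
  ∪ₛ⊆G x h with U x in ux
  ... | true  = U⊆G x ux
  ... | false = V⊆G x h

  ∪ₛ-above-U : {a x : Subset n} → U a ≡ true → a ⊆ x → (U ∪ₛ V) x ≡ U x
  ∪ₛ-above-U {a} {x} ua a⊆x = ∨-absorbʳ-by λ h → U-up a x ua (∪ₛ⊆G x h) a⊆x

  ∪ₛ-above-V : {a x : Subset n} → V a ≡ true → a ⊆ x → (U ∪ₛ V) x ≡ V x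
  ∪ₛ-above-V {a} {x} va a⊆x with U x in ux
  ... | true  = sym (V-up a x va (U⊆G x ux) a⊆x)
  ... | false = refl

  admits-∪ₛ : (x y : Subset n) → Admits (U ∪ₛ V) x y ≡ Admits U x y ∨ Admits V x y
  admits-∪ₛ x y =
    trans (∧-distribˡ-∨-under ((U ∪ₛ V) x) ((U ∪ₛ V) y) (U (x ∩ y)) (V (x ∩ y)))
          (cong₂ _∨_
            (∧-congʳ-when λ uz → ∪ₛ-above-U uz (p∩q⊆p x y) , ∪ₛ-above-U uz (p∩q⊆q x y))
            (∧-congʳ-when λ vz → ∪ₛ-above-V vz (p∩q⊆p x y) , ∪ₛ-above-V vz (p∩q⊆q x y)))

admits-∩ₛ : {n : ℕ} (U V : SetOfSimplices n) (x y : Subset n) →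
  Admits (U ∩ₛ V) x y ≡ Admits U x y ∧ Admits V x y
admits-∩ₛ U V x y = begin
  (U x ∧ V x) ∧ (U y ∧ V y) ∧ (U z ∧ V z)   ≡⟨ cong ((U x ∧ V x) ∧_) (interchange (U y) (V y) (U z) (V z)) ⟩
  (U x ∧ V x) ∧ (U y ∧ U z) ∧ (V y ∧ V z)   ≡⟨ interchange (U x) (V x) (U y ∧ U z) (V y ∧ V z) ⟩
  (U x ∧ U y ∧ U z) ∧ (V x ∧ V y ∧ V z)     ∎
  where
  open ≡-Reasoning
  z : Subset _
  z = x ∩ y

indicator : Bool → ℤ → ℤ
indicator b w = if b then w else pos 0

indicator-∨ : (a b : Bool) (w : ℤ) →
  indicator (a ∨ b) w ≡ (indicator a w + indicator b w) - indicator (a ∧ b) w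
indicator-∨ true  true  w = solve 1 (λ w → w := (w :+ w) :- w) refl w
indicator-∨ true  false w = solve 1 (λ w → w := (w :+ con (pos 0)) :- con (pos 0)) refl w
indicator-∨ false true  w = solve 1 (λ w → w := (con (pos 0) :+ w) :- con (pos 0)) refl w
indicator-∨ false false w = refl

sumL-linear : {A : Set} (xs : List A) {f g h k : A → ℤ} →
  ((a : A) → k a ≡ (f a + g a) - h a) →
  sumL xs k ≡ (sumL xs f + sumL xs g) - sumL xs h
sumL-linear []       _ = refl
sumL-linear (a ∷ xs) {f} {g} {h} e rewrite e a | sumL-linear xs e =
  solve 6 (λ a b c d e f → ((a :+ b) :- c) :+ ((d :+ e) :- f) := ((a :+ d) :+ (b :+ e)) :- (c :+ f))
    refl (f a) (g a) (h a) (sumL xs f) (sumL xs g) (sumL xs h)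

wu-∪ₛ : {n : ℕ} {G U V : SetOfSimplices n} →
  U ⊆ₛ G → V ⊆ₛ G → UpClosedIn G U → UpClosedIn G V →
  wu (U ∪ₛ V) ≡ (wu U + wu V) - wu (U ∩ₛ V)
wu-∪ₛ {n} {U = U} {V} U⊆G V⊆G U-up V-up =
  sumL-linear (allSubsets n) λ x → sumL-linear (allSubsets n) λ y →
    let w = ωs x * ωs y in begin
    indicator (Admits (U ∪ₛ V) x y) w
      ≡⟨ cong (λ b → indicator b w) (admits-∪ₛ U⊆G V⊆G U-up V-up x y) ⟩
    indicator (Admits U x y ∨ Admits V x y) w
      ≡⟨ indicator-∨ (Admits U x y) (Admits V x y) w ⟩
    (indicator (Admits U x y) w + indicator (Admits V x y) w) - indicator (Admits U x y ∧ Admits V x y) w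
      ≡⟨ cong (λ b → (indicator (Admits U x y) w + indicator (Admits V x y) w) - indicator b w)
              (sym (admits-∩ₛ U V x y)) ⟩
    (indicator (Admits U x y) w + indicator (Admits V x y) w) - indicator (Admits (U ∩ₛ V) x y) w ∎
  where open ≡-Reasoning

mainTheorem8 : (n : ℕ) (G : SetOfSimplices n) → IsComplex G →
    (U V : SetOfSimplices n) → IsOpen G U → IsOpen G V →
    wu (U ∪ₛ V) ≡ (wu U + wu V) - wu (U ∩ₛ V)
mainTheorem8 n _ _ U V U-open V-open =
  wu-∪ₛ (open⇒⊆ₛ U-open) (open⇒⊆ₛ V-open) (open⇒upClosed U-open) (open⇒upClosed V-open)
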